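{- Let $M$ be a uniform matroid of rank $r$ on $E=\{e_1,\dots,e_n\}$, $k\ge1$, and let each $e_i$ be active independently with probability $p_i$, where $p_1\ge\dots\ge p_n$. Assume $\mathrm{OPT}\ge200$. Let $M^*$ be the largest index with $\sum_{i=1}^{M^*}p_i<\mathrm{OPT}/2$. If $B_1,\dots,B_k$ are i.i.d. random variables with distribution $\mathrm{Bin}(r,p_{M^*+1})$, then $$\mathbb{E}\Big[\max_{i\in[k]}B_i\Big]\ge\frac{\mathrm{OPT}}{2}.$$
   Context: A portfolio is a collection of $k$ subsets of $E$ each of size at most $r$, with value $\mathbb{E}_A[\max_i|S_i\cap A|]$ where $A$ is the random set of active elements; $\mathrm{OPT}$ is the maximum value over portfolios.
   Formalization: The activation probabilities $p_i$ take values in the rationals. -}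

module Defs where

open import Data.Nat as ℕ using (ℕ; zero; suc; _∸_)
open import Data.Nat.Combinatorics using (_C_)
open import Data.Integer using (+_)
open import Data.Fin using (Fin; toℕ; fromℕ<)
import Data.Fin
open import Data.Fin.Subset using (Subset; inside; outside; _∩_; ∣_∣)
open import Data.Bool using (if_then_else_)
open import Data.Vec using (Vec; []; _∷_; lookup; map)
open import Data.List as List using (List; []; _∷_; _++_; concatMap)
open import Data.Rational using (ℚ; 0ℚ; 1ℚ; _+_; _*_; _-_; _/_; _≤_)

ℕ→ℚ : ℕ → ℚ
ℕ→ℚ m = (+ m) / 1

sumℚ : List ℚ → ℚ
sumℚ = List.foldr _+_ 0ℚ

ΣFin : (n : ℕ) → (Fin n → ℚ) → ℚ
ΣFin zero    f = 0ℚ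
ΣFin (suc n) f = f Data.Fin.zero + ΣFin n (λ i → f (Data.Fin.suc i))


ΠFin : (n : ℕ) → (Fin n → ℚ) → ℚ
ΠFin zero    f = 1ℚ
ΠFin (suc n) f = f Data.Fin.zero * ΠFin n (λ i → f (Data.Fin.suc i))


_^ℚ_ : ℚ → ℕ → ℚ
q ^ℚ zero  = 1ℚ
q ^ℚ suc m = q * (q ^ℚ m)

allVecs : ∀ {A : Set} → List A → (k : ℕ) → List (Vec A k)
allVecs xs zero    = [] ∷ []
allVecs xs (suc k) = concatMap (λ x → List.map (x ∷_) (allVecs xs k)) xs

allSubsets : (n : ℕ) → List (Subset n)
allSubsets n = allVecs (inside ∷ outside ∷ []) n

probSet : {n : ℕ} → (Fin n → ℚ) → Subset n → ℚ
probSet {n} p A = ΠFin n (λ i → if lookup A i then p i else (1ℚ - p i))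

maxVec : ∀ {k} → Vec ℕ k → ℕ
maxVec []       = 0
maxVec (x ∷ xs) = x ℕ.⊔ maxVec xs

-- a portfolio: k subsets of E, each of size at most r
-- (independent sets of the uniform matroid of rank r)
IsPortfolio : {n : ℕ} → (r k : ℕ) → Vec (Subset n) k → Set
IsPortfolio {n} r k S = (i : Fin k) → ∣ lookup S i ∣ ℕ.≤ r

value : {n k : ℕ} → (Fin n → ℚ) → Vec (Subset n) k → ℚ
value {n} p S =
  sumℚ (List.map (λ A → probSet p A * ℕ→ℚ (maxVec (map (λ Si → ∣ Si ∩ A ∣) S)))
                 (allSubsets n))

IsOPT : {n : ℕ} → (Fin n → ℚ) → (r k : ℕ) → ℚ → Set
IsOPT {n} p r k v =
  (Σ' (Vec (Subset n) k) (λ S → IsPortfolio r k S × value p S ≡ v))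
  × ((S : Vec (Subset n) k) → IsPortfolio r k S → value p S ≤ v)
  where
    open import Data.Product using (_×_) renaming (Σ to Σ')
    open import Relation.Binary.PropositionalEquality using (_≡_)

-- p extended by 0 to indices ≥ n (0-based: index j is element e_{j+1})
pAt : {n : ℕ} → (Fin n → ℚ) → ℕ → ℚ
pAt {zero}  p j       = 0ℚ
pAt {suc n} p zero    = p Data.Fin.zero
pAt {suc n} p (suc j) = pAt (λ i → p (Data.Fin.suc i)) j

prefixSum : {n : ℕ} → (Fin n → ℚ) → ℕ → ℚ
prefixSum p zero    = 0ℚ
prefixSum p (suc m) = prefixSum p m + pAt p m

binPmf : ℕ → ℚ → ℕ → ℚ
binPmf r q b = ℕ→ℚ (r C b) * (q ^ℚ b) * ((1ℚ - q) ^ℚ (r ∸ b))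

expMaxBin : (r k : ℕ) → ℚ → ℚ
expMaxBin r k q =
  sumℚ (List.map (λ bs → prodV bs * ℕ→ℚ (maxVec bs)) (allVecs (List.upTo (suc r)) k))
  where
    prodV : ∀ {m} → Vec ℕ m → ℚ
    prodV []       = 1ℚ
    prodV (b ∷ bs) = binPmf r q b * prodV bs

-- Fix a portfolio S, an index h and q ≥ p_j for all j ≥ h, and reveal the elements one at a time,
-- keeping for every set Sᵢ a budget of Bernoulli(q) trials that covers its unrevealed elements.
-- Each of the first h elements raises max_i |Sᵢ ∩ A| by at most one, at the cost of its
-- probability p_j.  A later element is one coin shared by all sets containing it; raising its
-- probability to q can only help, and so can replacing the shared coin by an independent coin per
-- set, because w ⊔ t is submodular in (w, t).  Once everything is revealed, the remaining budgets
-- are independent binomials with at most r trials, whence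
--   E[max_i |Sᵢ ∩ A|] ≤ p_1 + … + p_h + E[max_i B_i].
-- For an optimal portfolio and h = M* the left side is OPT and the prefix sum is below OPT/2.

module Submission where

open import Defs
open import Data.Nat using (ℕ; _≥_; _≤_)
open import Data.Fin using (Fin)
open import Data.Fin using (zero; suc; toℕ)
import Data.Fin
open import Data.Rational using (ℚ; 0ℚ; 1ℚ; ½; _*_)
open import Data.Rational as Q using ()

open import Data.Bool using (Bool; true; false; if_then_else_)
open import Data.Fin.Subset using (Subset; inside; outside; _∩_; ∣_∣)
import Data.Integer as ℤ
import Data.Integer.Properties as ℤP
open import Data.List as List using (List)
import Data.List.Properties as ListP
open import Data.Nat as ℕ using (zero; suc; _⊔_; _∸_; z≤n; s≤s)
open import Data.Nat.Combinatorics using (_C_; k>n⇒nCk≡0; nCk+nC[k+1]≡[n+1]C[k+1])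
import Data.Nat.Coprimality as Coprimality
import Data.Nat.Properties as ℕP
open import Data.Product using (Σ; _,_; proj₁; _×_)
open import Data.Rational using (_+_; _-_; -_; mkℚ) renaming (_≤_ to _≤ℚ_; _<_ to _<ℚ_)
import Data.Rational.Properties as QP
open import Data.Rational.Solver using (module +-*-Solver)
open import Data.Sum using (inj₁; inj₂)
open import Data.Vec as Vec using (Vec; []; _∷_)
import Data.Vec.Properties as VecP
open import Data.Vec.Relation.Binary.Pointwise.Inductive using (Pointwise; []; _∷_)
open import Data.Vec.Relation.Unary.All using (All; []; _∷_)
open import Function using (_∘_)
open import Relation.Binary.PropositionalEquality
open import Relation.Nullary using (Dec; yes; no)

open +-*-Solver using (solve; _:+_; _:*_; _:-_; :-_; con; _:=_)

0≤1 : 0ℚ ≤ℚ 1ℚ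
0≤1 = QP.nonNegative⁻¹ 1ℚ

0≤* : ∀ {a b} → 0ℚ ≤ℚ a → 0ℚ ≤ℚ b → 0ℚ ≤ℚ a * b
0≤* {a} {b} 0≤a 0≤b =
  QP.nonNegative⁻¹ (a * b) {{QP.nonNeg*nonNeg⇒nonNeg a {{Q.nonNegative 0≤a}} b {{Q.nonNegative 0≤b}}}}

*-monoˡ-≤ : ∀ {a x y} → 0ℚ ≤ℚ a → x ≤ℚ y → a * x ≤ℚ a * y
*-monoˡ-≤ {a} 0≤a = QP.*-monoˡ-≤-nonNeg a {{Q.nonNegative 0≤a}}

*-monoʳ-≤ : ∀ {a x y} → 0ℚ ≤ℚ a → x ≤ℚ y → x * a ≤ℚ y * a
*-monoʳ-≤ {a} 0≤a = QP.*-monoʳ-≤-nonNeg a {{Q.nonNegative 0≤a}}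

p≤q⇒0≤q-p : ∀ {p q} → p ≤ℚ q → 0ℚ ≤ℚ q - p
p≤q⇒0≤q-p {p} {q} p≤q = begin
  0ℚ     ≡⟨ QP.+-inverseʳ p ⟨
  p - p  ≤⟨ QP.+-monoˡ-≤ (- p) p≤q ⟩
  q - p  ∎
  where open QP.≤-Reasoning

p≤p+q : ∀ {p q} → 0ℚ ≤ℚ q → p ≤ℚ p + q
p≤p+q {p} {q} 0≤q = begin
  p       ≡⟨ QP.+-identityʳ p ⟨
  p + 0ℚ  ≤⟨ QP.+-monoʳ-≤ p 0≤q ⟩
  p + q   ∎
  where open QP.≤-Reasoning

+-cancelˡ-< : ∀ a {b c} → a + b <ℚ a + c → b <ℚ c
+-cancelˡ-< a {b} {c} a+b<a+c = subst₂ _<ℚ_ (-a+[a+x]≡x b) (-a+[a+x]≡x c) (QP.+-monoʳ-< (- a) a+b<a+c)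
  where
  -a+[a+x]≡x : ∀ x → - a + (a + x) ≡ x
  -a+[a+x]≡x x = solve 2 (λ a x → :- a :+ (a :+ x) := x) refl a x

mixture-mono : ∀ {p q X Y} → p ≤ℚ q → Y ≤ℚ X → p * X + (1ℚ - p) * Y ≤ℚ q * X + (1ℚ - q) * Y
mixture-mono {p} {q} {X} {Y} p≤q Y≤X = begin
  p * X + (1ℚ - p) * Y  ≡⟨ as-shift p ⟩
  Y + p * (X - Y)       ≤⟨ QP.+-monoʳ-≤ Y (*-monoʳ-≤ (p≤q⇒0≤q-p Y≤X) p≤q) ⟩
  Y + q * (X - Y)       ≡⟨ as-shift q ⟨
  q * X + (1ℚ - q) * Y  ∎
  where
  open QP.≤-Reasoning
  as-shift : ∀ z → z * X + (1ℚ - z) * Y ≡ Y + z * (X - Y)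
  as-shift z = solve 3 (λ z x y → z :* x :+ (con 1ℚ :- z) :* y := y :+ z :* (x :- y)) refl z X Y

convex-exchange : ∀ {q a b c d R₁ R₀} → 0ℚ ≤ℚ q → q ≤ℚ 1ℚ →
  q * a + (1ℚ - q) * b ≤ℚ R₁ → q * c + (1ℚ - q) * d ≤ℚ R₀ → a + d ≤ℚ b + c →
  q * a + (1ℚ - q) * d ≤ℚ q * R₁ + (1ℚ - q) * R₀
convex-exchange {q} {a} {b} {c} {d} {R₁} {R₀} 0≤q q≤1 ≤R₁ ≤R₀ a+d≤b+c = begin
  q * a + (1ℚ - q) * d
    ≤⟨ p≤p+q (0≤* (0≤* 0≤q (p≤q⇒0≤q-p q≤1)) (p≤q⇒0≤q-p a+d≤b+c)) ⟩
  q * a + (1ℚ - q) * d + q * (1ℚ - q) * ((b + c) - (a + d))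
    ≡⟨ expand ⟨
  q * (q * a + (1ℚ - q) * b) + (1ℚ - q) * (q * c + (1ℚ - q) * d)
    ≤⟨ QP.+-mono-≤ (*-monoˡ-≤ 0≤q ≤R₁) (*-monoˡ-≤ (p≤q⇒0≤q-p q≤1) ≤R₀) ⟩
  q * R₁ + (1ℚ - q) * R₀ ∎
  where
  open QP.≤-Reasoning
  expand : q * (q * a + (1ℚ - q) * b) + (1ℚ - q) * (q * c + (1ℚ - q) * d)
         ≡ q * a + (1ℚ - q) * d + q * (1ℚ - q) * ((b + c) - (a + d))
  expand = solve 5 (λ x a b c d →
    x :* (x :* a :+ (con 1ℚ :- x) :* b) :+ (con 1ℚ :- x) :* (x :* c :+ (con 1ℚ :- x) :* d)
      := x :* a :+ (con 1ℚ :- x) :* d :+ x :* (con 1ℚ :- x) :* ((b :+ c) :- (a :+ d))) refl q a b c d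

ℕ→ℚ≡mkℚ : ∀ m → ℕ→ℚ m ≡ mkℚ (ℤ.+ m) 0 (Coprimality.sym (Coprimality.1-coprimeTo m))
ℕ→ℚ≡mkℚ m = QP.↥p/↧p≡p (mkℚ (ℤ.+ m) 0 (Coprimality.sym (Coprimality.1-coprimeTo m)))

ℕ→ℚ-+ : ∀ a b → ℕ→ℚ (a ℕ.+ b) ≡ ℕ→ℚ a + ℕ→ℚ b
ℕ→ℚ-+ a b = sym (trans (cong₂ _+_ (ℕ→ℚ≡mkℚ a) (ℕ→ℚ≡mkℚ b))
  (QP./-cong (cong₂ ℤ._+_ (ℤP.*-identityʳ (ℤ.+ a)) (ℤP.*-identityʳ (ℤ.+ b))) refl))

ℕ→ℚ-mono : ∀ {a b} → a ≤ b → ℕ→ℚ a ≤ℚ ℕ→ℚ b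
ℕ→ℚ-mono {a} {b} a≤b rewrite ℕ→ℚ≡mkℚ a | ℕ→ℚ≡mkℚ b =
  Q.*≤* (subst₂ ℤ._≤_ (sym (ℤP.*-identityʳ (ℤ.+ a))) (sym (ℤP.*-identityʳ (ℤ.+ b))) (ℤ.+≤+ a≤b))

ℕ→ℚ-nonNeg : ∀ a → 0ℚ ≤ℚ ℕ→ℚ a
ℕ→ℚ-nonNeg a = ℕ→ℚ-mono {0} {a} z≤n

sumRange : ℕ → (ℕ → ℚ) → ℚ
sumRange zero    g = 0ℚ
sumRange (suc N) g = g 0 + sumRange N (g ∘ suc)

sumRange-cong : ∀ N {g h} → (∀ b → g b ≡ h b) → sumRange N g ≡ sumRange N h
sumRange-cong zero    g≡h = refl
sumRange-cong (suc N) g≡h = cong₂ _+_ (g≡h 0) (sumRange-cong N (g≡h ∘ suc))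

sumRange-mono : ∀ N {g h} → (∀ b → g b ≤ℚ h b) → sumRange N g ≤ℚ sumRange N h
sumRange-mono zero    g≤h = QP.≤-refl
sumRange-mono (suc N) g≤h = QP.+-mono-≤ (g≤h 0) (sumRange-mono N (g≤h ∘ suc))

sumRange-≡0 : ∀ N {g} → (∀ b → g b ≡ 0ℚ) → sumRange N g ≡ 0ℚ
sumRange-≡0 zero    g≡0 = refl
sumRange-≡0 (suc N) g≡0 = trans (cong₂ _+_ (g≡0 0) (sumRange-≡0 N (g≡0 ∘ suc))) (QP.+-identityʳ 0ℚ)

sumRange-+ : ∀ N g h → sumRange N (λ b → g b + h b) ≡ sumRange N g + sumRange N h
sumRange-+ zero    g h = sym (QP.+-identityʳ 0ℚ)
sumRange-+ (suc N) g h = trans (cong ((g 0 + h 0) +_) (sumRange-+ N (g ∘ suc) (h ∘ suc)))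
  (solve 4 (λ a b c d → (a :+ b) :+ (c :+ d) := (a :+ c) :+ (b :+ d)) refl
     (g 0) (h 0) (sumRange N (g ∘ suc)) (sumRange N (h ∘ suc)))

sumRange-*ˡ : ∀ N a g → sumRange N (λ b → a * g b) ≡ a * sumRange N g
sumRange-*ˡ zero    a g = sym (QP.*-zeroʳ a)
sumRange-*ˡ (suc N) a g = trans (cong ((a * g 0) +_) (sumRange-*ˡ N a (g ∘ suc)))
  (sym (QP.*-distribˡ-+ a (g 0) _))

sumRange-last : ∀ N g → sumRange (suc N) g ≡ sumRange N g + g N
sumRange-last zero    g = trans (QP.+-identityʳ (g 0)) (sym (QP.+-identityˡ (g 0)))
sumRange-last (suc N) g = trans (cong (g 0 +_) (sumRange-last N (g ∘ suc)))
  (sym (QP.+-assoc (g 0) _ _))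

sumℚ-map-upTo : ∀ N (g : ℕ → ℚ) → sumℚ (List.map g (List.upTo N)) ≡ sumRange N g
sumℚ-map-upTo N g = go N (λ b → b)
  where
  go : ∀ N f → sumℚ (List.map g (List.applyUpTo f N)) ≡ sumRange N (g ∘ f)
  go zero    f = refl
  go (suc N) f = cong (g (f 0) +_) (go N (f ∘ suc))

sumℚ-++ : ∀ xs ys → sumℚ (xs List.++ ys) ≡ sumℚ xs + sumℚ ys
sumℚ-++ List.[]       ys = sym (QP.+-identityˡ (sumℚ ys))
sumℚ-++ (x List.∷ xs) ys = trans (cong (x +_) (sumℚ-++ xs ys)) (sym (QP.+-assoc x (sumℚ xs) (sumℚ ys)))

sumℚ-map-*ˡ : ∀ {A : Set} a (f : A → ℚ) xs → sumℚ (List.map (λ x → a * f x) xs) ≡ a * sumℚ (List.map f xs)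
sumℚ-map-*ˡ a f List.[]       = sym (QP.*-zeroʳ a)
sumℚ-map-*ˡ a f (x List.∷ xs) = trans (cong ((a * f x) +_) (sumℚ-map-*ˡ a f xs))
  (sym (QP.*-distribˡ-+ a (f x) _))

sumℚ-map-concatMap : ∀ {A B : Set} (F : B → ℚ) (g : A → List B) xs →
  sumℚ (List.map F (List.concatMap g xs)) ≡ sumℚ (List.map (λ x → sumℚ (List.map F (g x))) xs)
sumℚ-map-concatMap F g List.[]       = refl
sumℚ-map-concatMap F g (x List.∷ xs) = begin
  sumℚ (List.map F (g x List.++ List.concatMap g xs))
    ≡⟨ cong sumℚ (ListP.map-++ F (g x) (List.concatMap g xs)) ⟩
  sumℚ (List.map F (g x) List.++ List.map F (List.concatMap g xs))
    ≡⟨ sumℚ-++ (List.map F (g x)) _ ⟩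
  sumℚ (List.map F (g x)) + sumℚ (List.map F (List.concatMap g xs))
    ≡⟨ cong (sumℚ (List.map F (g x)) +_) (sumℚ-map-concatMap F g xs) ⟩
  sumℚ (List.map (λ x → sumℚ (List.map F (g x))) (x List.∷ xs)) ∎
  where open ≡-Reasoning

sumℚ-allVecs-suc : ∀ {A : Set} (xs : List A) k (F : Vec A (suc k) → ℚ) →
  sumℚ (List.map F (allVecs xs (suc k)))
    ≡ sumℚ (List.map (λ x → sumℚ (List.map (λ v → F (x ∷ v)) (allVecs xs k))) xs)
sumℚ-allVecs-suc xs k F = trans (sumℚ-map-concatMap F (λ x → List.map (x ∷_) (allVecs xs k)) xs)
  (cong sumℚ (ListP.map-cong (λ x → cong sumℚ (sym (ListP.map-∘ (allVecs xs k)))) xs))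

^ℚ-nonNeg : ∀ {a} → 0ℚ ≤ℚ a → ∀ e → 0ℚ ≤ℚ a ^ℚ e
^ℚ-nonNeg 0≤a zero    = 0≤1
^ℚ-nonNeg 0≤a (suc e) = 0≤* 0≤a (^ℚ-nonNeg 0≤a e)

binPmf-nonNeg : ∀ {q} → 0ℚ ≤ℚ q → q ≤ℚ 1ℚ → ∀ m b → 0ℚ ≤ℚ binPmf m q b
binPmf-nonNeg 0≤q q≤1 m b =
  0≤* (0≤* (ℕ→ℚ-nonNeg (m C b)) (^ℚ-nonNeg 0≤q b)) (^ℚ-nonNeg (p≤q⇒0≤q-p q≤1) (m ∸ b))

binPmf-beyond : ∀ q {m b} → m ℕ.< b → binPmf m q b ≡ 0ℚ
binPmf-beyond q {m} {b} m<b rewrite k>n⇒nCk≡0 m<b =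
  trans (cong (_* (1ℚ - q) ^ℚ (m ∸ b)) (QP.*-zeroˡ (q ^ℚ b))) (QP.*-zeroˡ ((1ℚ - q) ^ℚ (m ∸ b)))

binPmf-suc-zero : ∀ q m → binPmf (suc m) q 0 ≡ (1ℚ - q) * binPmf m q 0
binPmf-suc-zero q m =
  solve 2 (λ x e → con 1ℚ :* con 1ℚ :* (x :* e) := x :* (con 1ℚ :* con 1ℚ :* e)) refl (1ℚ - q) ((1ℚ - q) ^ℚ m)

binPmf-suc-suc : ∀ q m b → binPmf (suc m) q (suc b) ≡ q * binPmf m q b + (1ℚ - q) * binPmf m q (suc b)
binPmf-suc-suc q m b = begin
  ℕ→ℚ (suc m C suc b) * (q * q ^ℚ b) * (1ℚ - q) ^ℚ (m ∸ b)
    ≡⟨ cong (λ n → n * (q * q ^ℚ b) * (1ℚ - q) ^ℚ (m ∸ b)) pascal ⟩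
  (ℕ→ℚ (m C b) + ℕ→ℚ (m C suc b)) * (q * q ^ℚ b) * (1ℚ - q) ^ℚ (m ∸ b)
    ≡⟨ split (b ℕ.<? m) ⟩
  q * binPmf m q b + (1ℚ - q) * binPmf m q (suc b) ∎
  where
  open ≡-Reasoning
  pascal : ℕ→ℚ (suc m C suc b) ≡ ℕ→ℚ (m C b) + ℕ→ℚ (m C suc b)
  pascal = trans (cong ℕ→ℚ (sym (nCk+nC[k+1]≡[n+1]C[k+1] m b))) (ℕ→ℚ-+ (m C b) (m C suc b))
  split : Dec (b ℕ.< m) →
    (ℕ→ℚ (m C b) + ℕ→ℚ (m C suc b)) * (q * q ^ℚ b) * (1ℚ - q) ^ℚ (m ∸ b)
      ≡ q * (ℕ→ℚ (m C b) * q ^ℚ b * (1ℚ - q) ^ℚ (m ∸ b))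
        + (1ℚ - q) * (ℕ→ℚ (m C suc b) * (q * q ^ℚ b) * (1ℚ - q) ^ℚ (m ∸ suc b))
  split (yes b<m) = shift (ℕP.+-∸-assoc 1 b<m)
    where
    shift : ∀ {e e′} → e ≡ suc e′ →
      (ℕ→ℚ (m C b) + ℕ→ℚ (m C suc b)) * (q * q ^ℚ b) * (1ℚ - q) ^ℚ e
        ≡ q * (ℕ→ℚ (m C b) * q ^ℚ b * (1ℚ - q) ^ℚ e)
          + (1ℚ - q) * (ℕ→ℚ (m C suc b) * (q * q ^ℚ b) * (1ℚ - q) ^ℚ e′)
    shift {e′ = e′} refl =
      solve 5 (λ c c′ x y e → (c :+ c′) :* (x :* y) :* ((con 1ℚ :- x) :* e)
                   := x :* (c :* y :* ((con 1ℚ :- x) :* e)) :+ (con 1ℚ :- x) :* (c′ :* (x :* y) :* e))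
        refl (ℕ→ℚ (m C b)) (ℕ→ℚ (m C suc b)) q (q ^ℚ b) ((1ℚ - q) ^ℚ e′)
  split (no b≮m) rewrite k>n⇒nCk≡0 (s≤s (ℕP.≮⇒≥ b≮m)) =
    solve 5 (λ c x y e e′ → (c :+ con 0ℚ) :* (x :* y) :* e
                 := x :* (c :* y :* e) :+ (con 1ℚ :- x) :* (con 0ℚ :* (x :* y) :* e′))
      refl (ℕ→ℚ (m C b)) q (q ^ℚ b) ((1ℚ - q) ^ℚ (m ∸ b)) ((1ℚ - q) ^ℚ (m ∸ suc b))

infixl 6 _⊕_
_⊕_ : ∀ {k} → Vec ℕ k → Vec ℕ k → Vec ℕ k
_⊕_ = Vec.zipWith ℕ._+_

⊕-assoc : ∀ {k} (u v w : Vec ℕ k) → (u ⊕ v) ⊕ w ≡ u ⊕ (v ⊕ w)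
⊕-assoc = VecP.zipWith-assoc ℕP.+-assoc

indicator : ∀ {k} → Vec Bool k → Vec ℕ k
indicator = Vec.map (λ b → if b then 1 else 0)

maxFrom : ∀ {k} → ℕ → Vec ℕ k → ℕ
maxFrom w []       = w
maxFrom w (x ∷ xs) = maxFrom (w ⊔ x) xs

maxFrom≡⊔maxVec : ∀ {k} w (v : Vec ℕ k) → maxFrom w v ≡ w ⊔ maxVec v
maxFrom≡⊔maxVec w []       = sym (ℕP.⊔-identityʳ w)
maxFrom≡⊔maxVec w (x ∷ xs) = trans (maxFrom≡⊔maxVec (w ⊔ x) xs) (ℕP.⊔-assoc w x (maxVec xs))

⊔-submodular : ∀ {a₀ a₁ t s} → a₀ ≤ a₁ → t ≤ s → (a₁ ⊔ s) ℕ.+ (a₀ ⊔ t) ≤ (a₁ ⊔ t) ℕ.+ (a₀ ⊔ s)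
⊔-submodular {a₀} {a₁} {t} {s} a₀≤a₁ t≤s with ℕP.≤-total a₁ t
... | inj₁ a₁≤t
  rewrite ℕP.m≤n⇒m⊔n≡n (ℕP.≤-trans a₁≤t t≤s) | ℕP.m≤n⇒m⊔n≡n (ℕP.≤-trans a₀≤a₁ a₁≤t)
        | ℕP.m≤n⇒m⊔n≡n a₁≤t | ℕP.m≤n⇒m⊔n≡n (ℕP.≤-trans a₀≤a₁ (ℕP.≤-trans a₁≤t t≤s)) =
  ℕP.≤-reflexive (ℕP.+-comm s t)
... | inj₂ t≤a₁ rewrite ℕP.m≥n⇒m⊔n≡m t≤a₁ with ℕP.≤-total s a₁
...   | inj₁ s≤a₁ rewrite ℕP.m≥n⇒m⊔n≡m s≤a₁ = ℕP.+-monoʳ-≤ a₁ (ℕP.⊔-monoʳ-≤ a₀ t≤s)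
...   | inj₂ a₁≤s rewrite ℕP.m≤n⇒m⊔n≡n a₁≤s | ℕP.m≤n⇒m⊔n≡n (ℕP.≤-trans a₀≤a₁ a₁≤s) =
  ℕP.≤-trans (ℕP.+-monoʳ-≤ s (ℕP.⊔-lub a₀≤a₁ t≤a₁)) (ℕP.≤-reflexive (ℕP.+-comm s a₁))

maxVec-⊕-≥ : ∀ {k} (c bs : Vec ℕ k) → maxVec c ≤ maxVec (c ⊕ bs)
maxVec-⊕-≥ []       []        = z≤n
maxVec-⊕-≥ (c₀ ∷ c) (b₀ ∷ bs) = ℕP.⊔-mono-≤ (ℕP.m≤m+n c₀ b₀) (maxVec-⊕-≥ c bs)

maxVec-indicator-≥ : ∀ {k} (I : Vec Bool k) (c bs : Vec ℕ k) →
  maxVec (c ⊕ bs) ≤ maxVec (c ⊕ (indicator I ⊕ bs))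
maxVec-indicator-≥ []      []       []        = z≤n
maxVec-indicator-≥ (i ∷ I) (c₀ ∷ c) (b₀ ∷ bs) =
  ℕP.⊔-mono-≤ (ℕP.+-monoʳ-≤ c₀ (ℕP.m≤n+m b₀ _)) (maxVec-indicator-≥ I c bs)

maxVec-indicator-≤ : ∀ {k} (I : Vec Bool k) (c bs : Vec ℕ k) →
  maxVec (c ⊕ (indicator I ⊕ bs)) ≤ suc (maxVec (c ⊕ bs))
maxVec-indicator-≤ []      []       []        = z≤n
maxVec-indicator-≤ (i ∷ I) (c₀ ∷ c) (b₀ ∷ bs) =
  ℕP.⊔-lub (ℕP.≤-trans (head≤ i) (s≤s (ℕP.m≤m⊔n _ _)))
           (ℕP.≤-trans (maxVec-indicator-≤ I c bs) (s≤s (ℕP.m≤n⊔m _ _)))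
  where
  head≤ : ∀ i → c₀ ℕ.+ ((if i then 1 else 0) ℕ.+ b₀) ≤ suc (c₀ ℕ.+ b₀)
  head≤ true  = ℕP.≤-reflexive (ℕP.+-suc c₀ b₀)
  head≤ false = ℕP.n≤1+n _

maxℚ : ∀ {k} → ℕ → Vec ℕ k → ℚ
maxℚ w v = ℕ→ℚ (maxFrom w v)

maxℚ-mono : ∀ {k} w (u v : Vec ℕ k) → maxVec u ≤ maxVec v → maxℚ w u ≤ℚ maxℚ w v
maxℚ-mono w u v u≤v = ℕ→ℚ-mono ineq
  where
  ineq : maxFrom w u ≤ maxFrom w v
  ineq rewrite maxFrom≡⊔maxVec w u | maxFrom≡⊔maxVec w v = ℕP.⊔-monoʳ-≤ w u≤v

maxℚ-≤1+ : ∀ {k} w (u v : Vec ℕ k) → maxVec u ≤ suc (maxVec v) → maxℚ w u ≤ℚ 1ℚ + maxℚ w v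
maxℚ-≤1+ w u v u≤1+v = QP.≤-trans (ℕ→ℚ-mono ineq) (QP.≤-reflexive (ℕ→ℚ-+ 1 (maxFrom w v)))
  where
  ineq : maxFrom w u ≤ suc (maxFrom w v)
  ineq rewrite maxFrom≡⊔maxVec w u | maxFrom≡⊔maxVec w v =
    ℕP.⊔-lub (ℕP.≤-trans (ℕP.m≤m⊔n w _) (ℕP.n≤1+n _)) (ℕP.≤-trans u≤1+v (s≤s (ℕP.m≤n⊔m w _)))

maxℚ-submodular : ∀ {k w₀ w₁} (u v : Vec ℕ k) → w₀ ≤ w₁ → maxVec u ≤ maxVec v →
  maxℚ w₁ v + maxℚ w₀ u ≤ℚ maxℚ w₁ u + maxℚ w₀ v
maxℚ-submodular {w₀ = w₀} {w₁} u v w₀≤w₁ u≤v = begin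
  maxℚ w₁ v + maxℚ w₀ u                  ≡⟨ ℕ→ℚ-+ (maxFrom w₁ v) (maxFrom w₀ u) ⟨
  ℕ→ℚ (maxFrom w₁ v ℕ.+ maxFrom w₀ u)  ≤⟨ ℕ→ℚ-mono ineq ⟩
  ℕ→ℚ (maxFrom w₁ u ℕ.+ maxFrom w₀ v)  ≡⟨ ℕ→ℚ-+ (maxFrom w₁ u) (maxFrom w₀ v) ⟩
  maxℚ w₁ u + maxℚ w₀ v                  ∎
  where
  open QP.≤-Reasoning
  ineq : maxFrom w₁ v ℕ.+ maxFrom w₀ u ≤ maxFrom w₁ u ℕ.+ maxFrom w₀ v
  ineq rewrite maxFrom≡⊔maxVec w₁ v | maxFrom≡⊔maxVec w₀ u
             | maxFrom≡⊔maxVec w₁ u | maxFrom≡⊔maxVec w₀ v =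
    ⊔-submodular w₀≤w₁ u≤v

maxℚ-zeros : ∀ {k} (v : Vec ℕ k) → maxℚ 0 (Vec.replicate k 0 ⊕ v) ≡ ℕ→ℚ (maxVec v)
maxℚ-zeros v =
  cong ℕ→ℚ (trans (cong (maxFrom 0) (VecP.zipWith-identityˡ ℕP.+-identityˡ v)) (maxFrom≡⊔maxVec 0 v))

expSubset : ∀ {n} → (Fin n → ℚ) → (Subset n → ℚ) → ℚ
expSubset {zero}  p f = f []
expSubset {suc n} p f = p zero * expSubset (p ∘ suc) (f ∘ (inside ∷_))
                      + (1ℚ - p zero) * expSubset (p ∘ suc) (f ∘ (outside ∷_))

expSubset-cong : ∀ {n} (p : Fin n → ℚ) {f g} → (∀ A → f A ≡ g A) → expSubset p f ≡ expSubset p g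
expSubset-cong {zero}  p f≡g = f≡g []
expSubset-cong {suc n} p f≡g =
  cong₂ _+_ (cong (p zero *_) (expSubset-cong (p ∘ suc) (f≡g ∘ (inside ∷_))))
            (cong ((1ℚ - p zero) *_) (expSubset-cong (p ∘ suc) (f≡g ∘ (outside ∷_))))

sumℚ-probSet≡expSubset : ∀ {n} (p : Fin n → ℚ) (f : Subset n → ℚ) →
  sumℚ (List.map (λ A → probSet p A * f A) (allSubsets n)) ≡ expSubset p f
sumℚ-probSet≡expSubset {zero}  p f = trans (QP.+-identityʳ _) (QP.*-identityˡ (f []))
sumℚ-probSet≡expSubset {suc n} p f = begin
  sumℚ (List.map (λ A → probSet p A * f A) (allSubsets (suc n)))
    ≡⟨ sumℚ-allVecs-suc (inside List.∷ outside List.∷ List.[]) n _ ⟩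
  part inside + (part outside + 0ℚ)
    ≡⟨ cong₂ _+_ (factor inside) (trans (QP.+-identityʳ _) (factor outside)) ⟩
  expSubset p f ∎
  where
  open ≡-Reasoning
  weight : Bool → ℚ
  weight x = if x then p zero else 1ℚ - p zero
  part : Bool → ℚ
  part x = sumℚ (List.map (λ A → probSet p (x ∷ A) * f (x ∷ A)) (allSubsets n))
  factor : ∀ x → part x ≡ weight x * expSubset (p ∘ suc) (f ∘ (x ∷_))
  factor x = begin
    part x
      ≡⟨ cong sumℚ (ListP.map-cong (λ A → QP.*-assoc (weight x) (probSet (p ∘ suc) A) (f (x ∷ A)))
                                   (allSubsets n)) ⟩
    sumℚ (List.map (λ A → weight x * (probSet (p ∘ suc) A * f (x ∷ A))) (allSubsets n))
      ≡⟨ sumℚ-map-*ˡ (weight x) _ (allSubsets n) ⟩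
    weight x * sumℚ (List.map (λ A → probSet (p ∘ suc) A * f (x ∷ A)) (allSubsets n))
      ≡⟨ cong (weight x *_) (sumℚ-probSet≡expSubset (p ∘ suc) (f ∘ (x ∷_))) ⟩
    weight x * expSubset (p ∘ suc) (f ∘ (x ∷_)) ∎

counts : ∀ {n k} → Vec (Subset n) k → Subset n → Vec ℕ k
counts S A = Vec.map (λ Sᵢ → ∣ Sᵢ ∩ A ∣) S

heads : ∀ {n k} → Vec (Subset (suc n)) k → Vec Bool k
heads = Vec.map Vec.head

tails : ∀ {n k} → Vec (Subset (suc n)) k → Vec (Subset n) k
tails = Vec.map Vec.tail

counts-inside : ∀ {n k} (S : Vec (Subset (suc n)) k) A →
  counts S (inside ∷ A) ≡ indicator (heads S) ⊕ counts (tails S) A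
counts-inside []                A = refl
counts-inside ((true  ∷ v) ∷ S) A = cong (suc ∣ v ∩ A ∣ ∷_) (counts-inside S A)
counts-inside ((false ∷ v) ∷ S) A = cong (∣ v ∩ A ∣ ∷_) (counts-inside S A)

counts-outside : ∀ {n k} (S : Vec (Subset (suc n)) k) A → counts S (outside ∷ A) ≡ counts (tails S) A
counts-outside []                A = refl
counts-outside ((true  ∷ v) ∷ S) A = cong (∣ v ∩ A ∣ ∷_) (counts-outside S A)
counts-outside ((false ∷ v) ∷ S) A = cong (∣ v ∩ A ∣ ∷_) (counts-outside S A)

counts-empty : ∀ {k} (S : Vec (Subset 0) k) (c : Vec ℕ k) → c ⊕ counts S [] ≡ c
counts-empty []       []       = refl
counts-empty ([] ∷ S) (c₀ ∷ c) = cong₂ _∷_ (ℕP.+-identityʳ c₀) (counts-empty S c)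

expSubset-counts : ∀ {n k} (p : Fin (suc n) → ℚ) (S : Vec (Subset (suc n)) k) c (g : Vec ℕ k → ℚ) →
  expSubset p (λ A → g (c ⊕ counts S A))
    ≡ p zero * expSubset (p ∘ suc) (λ A → g ((c ⊕ indicator (heads S)) ⊕ counts (tails S) A))
      + (1ℚ - p zero) * expSubset (p ∘ suc) (λ A → g (c ⊕ counts (tails S) A))
expSubset-counts p S c g = cong₂ _+_
  (cong (p zero *_) (expSubset-cong (p ∘ suc) (λ A → cong g (begin
    c ⊕ counts S (inside ∷ A)                           ≡⟨ cong (c ⊕_) (counts-inside S A) ⟩
    c ⊕ (indicator (heads S) ⊕ counts (tails S) A)      ≡⟨ ⊕-assoc c _ _ ⟨
    (c ⊕ indicator (heads S)) ⊕ counts (tails S) A      ∎))))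
  (cong ((1ℚ - p zero) *_) (expSubset-cong (p ∘ suc) (λ A → cong (λ v → g (c ⊕ v)) (counts-outside S A))))
  where open ≡-Reasoning

sizeFrom : ∀ {n} → ℕ → Subset n → ℕ
sizeFrom zero    v       = ∣ v ∣
sizeFrom (suc h) []      = 0
sizeFrom (suc h) (_ ∷ v) = sizeFrom h v

sizeFrom≤size : ∀ {n} h (v : Subset n) → sizeFrom h v ≤ ∣ v ∣
sizeFrom≤size zero    v           = ℕP.≤-refl
sizeFrom≤size (suc h) []          = z≤n
sizeFrom≤size (suc h) (true  ∷ v) = ℕP.m≤n⇒m≤1+n (sizeFrom≤size h v)
sizeFrom≤size (suc h) (false ∷ v) = sizeFrom≤size h v

FitsFrom : ∀ {n k} → ℕ → Vec (Subset n) k → Vec ℕ k → Set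
FitsFrom h = Pointwise (λ Sᵢ mᵢ → sizeFrom h Sᵢ ≤ mᵢ)

FitsFrom-suc : ∀ {n k h} (S : Vec (Subset (suc n)) k) {m} → FitsFrom (suc h) S m → FitsFrom h (tails S) m
FitsFrom-suc []            []            = []
FitsFrom-suc ((_ ∷ _) ∷ S) (fits₀ ∷ fits) = fits₀ ∷ FitsFrom-suc S fits

FitsFrom-zero : ∀ {n k} (S : Vec (Subset (suc n)) k) {m} → FitsFrom 0 S m →
  Σ (Vec ℕ k) λ m′ → m ≡ indicator (heads S) ⊕ m′ × FitsFrom 0 (tails S) m′
FitsFrom-zero [] [] = [] , refl , []
FitsFrom-zero ((true ∷ v) ∷ S) (s≤s fits₀ ∷ fits) with FitsFrom-zero S fits
... | m′ , refl , fits′ = (_ ∷ m′) , refl , (fits₀ ∷ fits′)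
FitsFrom-zero ((false ∷ v) ∷ S) (fits₀ ∷ fits) with FitsFrom-zero S fits
... | m′ , refl , fits′ = (_ ∷ m′) , refl , (fits₀ ∷ fits′)

IsPortfolio⇒FitsFrom : ∀ {n k r} h (S : Vec (Subset n) k) → IsPortfolio r k S →
  FitsFrom h S (Vec.replicate k r)
IsPortfolio⇒FitsFrom h []       _         = []
IsPortfolio⇒FitsFrom h (Sᵢ ∷ S) portfolio =
  ℕP.≤-trans (sizeFrom≤size h Sᵢ) (portfolio zero) ∷ IsPortfolio⇒FitsFrom h S (portfolio ∘ suc)

prefixSum-empty : ∀ (p : Fin 0 → ℚ) h → prefixSum p h ≡ 0ℚ
prefixSum-empty p zero    = refl
prefixSum-empty p (suc h) = trans (QP.+-identityʳ _) (prefixSum-empty p h)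

prefixSum-suc : ∀ {n} (p : Fin (suc n) → ℚ) h → prefixSum p (suc h) ≡ p zero + prefixSum (p ∘ suc) h
prefixSum-suc p zero    = trans (QP.+-identityˡ (p zero)) (sym (QP.+-identityʳ (p zero)))
prefixSum-suc p (suc h) = trans (cong (_+ pAt (p ∘ suc) h) (prefixSum-suc p h)) (QP.+-assoc (p zero) _ _)

module Binomial (r : ℕ) (q : ℚ) (0≤q : 0ℚ ≤ℚ q) (q≤1 : q ≤ℚ 1ℚ) where

  open QP.≤-Reasoning

  -- The sum stops at r, so this is the expectation over Bin(m, q) only for m ≤ r.
  expBin : ℕ → (ℕ → ℚ) → ℚ
  expBin m g = sumRange (suc r) (λ b → binPmf m q b * g b)

  expBin-cong : ∀ m {g h} → (∀ b → g b ≡ h b) → expBin m g ≡ expBin m h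
  expBin-cong m g≡h = sumRange-cong (suc r) (λ b → cong (binPmf m q b *_) (g≡h b))

  expBin-mono : ∀ m {g h} → (∀ b → g b ≤ℚ h b) → expBin m g ≤ℚ expBin m h
  expBin-mono m g≤h = sumRange-mono (suc r) (λ b → *-monoˡ-≤ (binPmf-nonNeg 0≤q q≤1 m b) (g≤h b))

  expBin-+ : ∀ m g h → expBin m (λ b → g b + h b) ≡ expBin m g + expBin m h
  expBin-+ m g h = trans (sumRange-cong (suc r) (λ b → QP.*-distribˡ-+ (binPmf m q b) (g b) (h b)))
    (sumRange-+ (suc r) (λ b → binPmf m q b * g b) (λ b → binPmf m q b * h b))

  expBin-*ˡ : ∀ m a g → expBin m (λ b → a * g b) ≡ a * expBin m g
  expBin-*ˡ m a g = trans
    (sumRange-cong (suc r) (λ b → solve 3 (λ π a x → π :* (a :* x) := a :* (π :* x)) refl (binPmf m q b) a (g b)))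
    (sumRange-*ˡ (suc r) a (λ b → binPmf m q b * g b))

  expBin-linear : ∀ m a c g h → expBin m (λ b → a * g b + c * h b) ≡ a * expBin m g + c * expBin m h
  expBin-linear m a c g h = trans (expBin-+ m (λ b → a * g b) (λ b → c * h b))
    (cong₂ _+_ (expBin-*ˡ m a g) (expBin-*ˡ m c h))

  expBin-suc : ∀ m g → m ℕ.< r → expBin (suc m) g ≡ q * expBin m (g ∘ suc) + (1ℚ - q) * expBin m g
  expBin-suc m g m<r = begin-equality
    expBin (suc m) g
      ≡⟨ cong₂ _+_ (cong (_* g 0) (binPmf-suc-zero q m)) shifted ⟩
    (1ℚ - q) * binPmf m q 0 * g 0 + (q * S₁ + (1ℚ - q) * S₂)
      ≡⟨ solve 5 (λ x π g₀ s₁ s₂ → (con 1ℚ :- x) :* π :* g₀ :+ (x :* s₁ :+ (con 1ℚ :- x) :* s₂)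
                                    := x :* s₁ :+ (con 1ℚ :- x) :* (π :* g₀ :+ s₂))
                 refl q (binPmf m q 0) (g 0) S₁ S₂ ⟩
    q * S₁ + (1ℚ - q) * expBin m g
      ≡⟨ cong (λ s → q * s + (1ℚ - q) * expBin m g) S₁≡expBin ⟨
    q * expBin m (g ∘ suc) + (1ℚ - q) * expBin m g ∎
    where
    S₁ S₂ : ℚ
    S₁ = sumRange r (λ b → binPmf m q b * g (suc b))
    S₂ = sumRange r (λ b → binPmf m q (suc b) * g (suc b))
    shifted : sumRange r (λ b → binPmf (suc m) q (suc b) * g (suc b)) ≡ q * S₁ + (1ℚ - q) * S₂
    shifted = begin-equality
      sumRange r (λ b → binPmf (suc m) q (suc b) * g (suc b))
        ≡⟨ sumRange-cong r (λ b → cong (_* g (suc b)) (binPmf-suc-suc q m b)) ⟩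
      sumRange r (λ b → (q * binPmf m q b + (1ℚ - q) * binPmf m q (suc b)) * g (suc b))
        ≡⟨ sumRange-cong r (λ b → solve 4 (λ x π π′ y → (x :* π :+ (con 1ℚ :- x) :* π′) :* y
                                                  := x :* (π :* y) :+ (con 1ℚ :- x) :* (π′ :* y))
                                       refl q (binPmf m q b) (binPmf m q (suc b)) (g (suc b))) ⟩
      sumRange r (λ b → q * (binPmf m q b * g (suc b)) + (1ℚ - q) * (binPmf m q (suc b) * g (suc b)))
        ≡⟨ sumRange-+ r _ _ ⟩
      sumRange r (λ b → q * (binPmf m q b * g (suc b)))
        + sumRange r (λ b → (1ℚ - q) * (binPmf m q (suc b) * g (suc b)))
        ≡⟨ cong₂ _+_ (sumRange-*ˡ r q _) (sumRange-*ˡ r (1ℚ - q) _) ⟩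
      q * S₁ + (1ℚ - q) * S₂ ∎
    S₁≡expBin : expBin m (g ∘ suc) ≡ S₁
    S₁≡expBin = begin-equality
      expBin m (g ∘ suc)             ≡⟨ sumRange-last r (λ b → binPmf m q b * g (suc b)) ⟩
      S₁ + binPmf m q r * g (suc r)  ≡⟨ cong (λ π → S₁ + π * g (suc r)) (binPmf-beyond q m<r) ⟩
      S₁ + 0ℚ * g (suc r)            ≡⟨ cong (S₁ +_) (QP.*-zeroˡ (g (suc r))) ⟩
      S₁ + 0ℚ                        ≡⟨ QP.+-identityʳ S₁ ⟩
      S₁                             ∎

  expBin-const : ∀ m c → m ≤ r → expBin m (λ _ → c) ≡ c
  expBin-const zero c _ = begin-equality
    1ℚ * c + sumRange r (λ b → binPmf 0 q (suc b) * c)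
      ≡⟨ cong (1ℚ * c +_) (sumRange-≡0 r (λ b →
           trans (cong (_* c) (binPmf-beyond q {b = suc b} (s≤s z≤n))) (QP.*-zeroˡ c))) ⟩
    1ℚ * c + 0ℚ  ≡⟨ trans (QP.+-identityʳ _) (QP.*-identityˡ c) ⟩
    c ∎
  expBin-const (suc m) c m<r = begin-equality
    expBin (suc m) (λ _ → c)                          ≡⟨ expBin-suc m (λ _ → c) m<r ⟩
    q * expBin m (λ _ → c) + (1ℚ - q) * expBin m (λ _ → c)
      ≡⟨ cong (λ e → q * e + (1ℚ - q) * e) (expBin-const m c (ℕP.<⇒≤ m<r)) ⟩
    q * c + (1ℚ - q) * c                              ≡⟨ solve 2 (λ x c → x :* c :+ (con 1ℚ :- x) :* c := c) refl q c ⟩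
    c ∎

  expBins : ∀ {k} → Vec ℕ k → (Vec ℕ k → ℚ) → ℚ
  expBins []       f = f []
  expBins (m ∷ ms) f = expBin m (λ b → expBins ms (f ∘ (b ∷_)))

  expBins-cong : ∀ {k} (ms : Vec ℕ k) {f g} → (∀ bs → f bs ≡ g bs) → expBins ms f ≡ expBins ms g
  expBins-cong []       f≡g = f≡g []
  expBins-cong (m ∷ ms) f≡g = expBin-cong m (λ b → expBins-cong ms (f≡g ∘ (b ∷_)))

  expBins-mono : ∀ {k} (ms : Vec ℕ k) {f g} → (∀ bs → f bs ≤ℚ g bs) → expBins ms f ≤ℚ expBins ms g
  expBins-mono []       f≤g = f≤g []
  expBins-mono (m ∷ ms) f≤g = expBin-mono m (λ b → expBins-mono ms (f≤g ∘ (b ∷_)))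

  expBins-+ : ∀ {k} (ms : Vec ℕ k) f g → expBins ms (λ bs → f bs + g bs) ≡ expBins ms f + expBins ms g
  expBins-+ []       f g = refl
  expBins-+ (m ∷ ms) f g = trans (expBin-cong m (λ b → expBins-+ ms (f ∘ (b ∷_)) (g ∘ (b ∷_))))
    (expBin-+ m (λ b → expBins ms (f ∘ (b ∷_))) (λ b → expBins ms (g ∘ (b ∷_))))

  expBins-const : ∀ {k} (ms : Vec ℕ k) c → All (_≤ r) ms → expBins ms (λ _ → c) ≡ c
  expBins-const []       c []            = refl
  expBins-const (m ∷ ms) c (m≤r ∷ ms≤r) =
    trans (expBin-cong m (λ _ → expBins-const ms c ms≤r)) (expBin-const m c m≤r)

  expBins-1+ : ∀ {k} (ms : Vec ℕ k) f → All (_≤ r) ms → expBins ms (λ bs → 1ℚ + f bs) ≡ 1ℚ + expBins ms f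
  expBins-1+ ms f ms≤r = trans (expBins-+ ms (λ _ → 1ℚ) f) (cong (_+ expBins ms f) (expBins-const ms 1ℚ ms≤r))

  maxℚ≤expBins : ∀ {k} w (c ms : Vec ℕ k) → All (_≤ r) ms → maxℚ w c ≤ℚ expBins ms (λ bs → maxℚ w (c ⊕ bs))
  maxℚ≤expBins w c ms ms≤r = begin
    maxℚ w c                              ≡⟨ expBins-const ms (maxℚ w c) ms≤r ⟨
    expBins ms (λ _ → maxℚ w c)           ≤⟨ expBins-mono ms (λ bs → maxℚ-mono w c (c ⊕ bs) (maxVec-⊕-≥ c bs)) ⟩
    expBins ms (λ bs → maxℚ w (c ⊕ bs))   ∎

  expBins-⊕-assoc : ∀ {k} w (c u ms : Vec ℕ k) →
    expBins ms (λ bs → maxℚ w ((c ⊕ u) ⊕ bs)) ≡ expBins ms (λ bs → maxℚ w (c ⊕ (u ⊕ bs)))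
  expBins-⊕-assoc w c u ms = expBins-cong ms (λ bs → cong (maxℚ w) (⊕-assoc c u bs))

  expBins-submodular : ∀ {k w₀ w₁} (I : Vec Bool k) (c ms : Vec ℕ k) → w₀ ≤ w₁ →
    expBins ms (λ bs → maxℚ w₁ (c ⊕ (indicator I ⊕ bs))) + expBins ms (λ bs → maxℚ w₀ (c ⊕ bs))
      ≤ℚ expBins ms (λ bs → maxℚ w₁ (c ⊕ bs)) + expBins ms (λ bs → maxℚ w₀ (c ⊕ (indicator I ⊕ bs)))
  expBins-submodular {w₀ = w₀} {w₁} I c ms w₀≤w₁ = begin
    expBins ms (λ bs → maxℚ w₁ (c ⊕ (indicator I ⊕ bs))) + expBins ms (λ bs → maxℚ w₀ (c ⊕ bs))
      ≡⟨ expBins-+ ms _ _ ⟨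
    expBins ms (λ bs → maxℚ w₁ (c ⊕ (indicator I ⊕ bs)) + maxℚ w₀ (c ⊕ bs))
      ≤⟨ expBins-mono ms (λ bs →
           maxℚ-submodular (c ⊕ bs) (c ⊕ (indicator I ⊕ bs)) w₀≤w₁ (maxVec-indicator-≥ I c bs)) ⟩
    expBins ms (λ bs → maxℚ w₁ (c ⊕ bs) + maxℚ w₀ (c ⊕ (indicator I ⊕ bs)))
      ≡⟨ expBins-+ ms _ _ ⟩
    expBins ms (λ bs → maxℚ w₁ (c ⊕ bs)) + expBins ms (λ bs → maxℚ w₀ (c ⊕ (indicator I ⊕ bs))) ∎

  -- On the left a single Bernoulli(q) coin is added to every coordinate in I; on the right each
  -- coordinate in I has one more trial, i.e. its own independent coin.
  sharedCoin≤independentCoins : ∀ {k} w (I : Vec Bool k) (c ms : Vec ℕ k) → All (_≤ r) (indicator I ⊕ ms) →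
    q * expBins ms (λ bs → maxℚ w (c ⊕ (indicator I ⊕ bs))) + (1ℚ - q) * expBins ms (λ bs → maxℚ w (c ⊕ bs))
      ≤ℚ expBins (indicator I ⊕ ms) (λ bs → maxℚ w (c ⊕ bs))
  sharedCoin≤independentCoins w [] [] [] [] =
    QP.≤-reflexive (solve 2 (λ x a → x :* a :+ (con 1ℚ :- x) :* a := a) refl q (maxℚ w []))
  sharedCoin≤independentCoins w (false ∷ I) (c₀ ∷ c) (m ∷ ms) (_ ∷ ms≤r) = begin
    q * expBin m A + (1ℚ - q) * expBin m D     ≡⟨ expBin-linear m q (1ℚ - q) A D ⟨
    expBin m (λ b → q * A b + (1ℚ - q) * D b)
      ≤⟨ expBin-mono m (λ b → sharedCoin≤independentCoins (w₀ b) I c ms ms≤r) ⟩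
    expBin m R                                 ∎
    where
    w₀ : ℕ → ℕ
    w₀ b = w ⊔ (c₀ ℕ.+ b)
    A D R : ℕ → ℚ
    A b = expBins ms (λ bs → maxℚ (w₀ b) (c ⊕ (indicator I ⊕ bs)))
    D b = expBins ms (λ bs → maxℚ (w₀ b) (c ⊕ bs))
    R b = expBins (indicator I ⊕ ms) (λ bs → maxℚ (w₀ b) (c ⊕ bs))
  sharedCoin≤independentCoins w (true ∷ I) (c₀ ∷ c) (m ∷ ms) (m<r ∷ ms≤r) = begin
    q * expBin m A + (1ℚ - q) * expBin m D                 ≡⟨ expBin-linear m q (1ℚ - q) A D ⟨
    expBin m (λ b → q * A b + (1ℚ - q) * D b)              ≤⟨ expBin-mono m exchange ⟩
    expBin m (λ b → q * R (suc b) + (1ℚ - q) * R b)        ≡⟨ expBin-linear m q (1ℚ - q) (R ∘ suc) R ⟩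
    q * expBin m (R ∘ suc) + (1ℚ - q) * expBin m R         ≡⟨ expBin-suc m R m<r ⟨
    expBin (suc m) R                                       ∎
    where
    w₀ w₁ : ℕ → ℕ
    w₀ b = w ⊔ (c₀ ℕ.+ b)
    w₁ b = w ⊔ (c₀ ℕ.+ suc b)
    A D R : ℕ → ℚ
    A b = expBins ms (λ bs → maxℚ (w₁ b) (c ⊕ (indicator I ⊕ bs)))
    D b = expBins ms (λ bs → maxℚ (w₀ b) (c ⊕ bs))
    R b = expBins (indicator I ⊕ ms) (λ bs → maxℚ (w₀ b) (c ⊕ bs))
    exchange : ∀ b → q * A b + (1ℚ - q) * D b ≤ℚ q * R (suc b) + (1ℚ - q) * R b
    exchange b = convex-exchange 0≤q q≤1
      (sharedCoin≤independentCoins (w₁ b) I c ms ms≤r)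
      (sharedCoin≤independentCoins (w₀ b) I c ms ms≤r)
      (expBins-submodular I c ms (ℕP.⊔-monoʳ-≤ w (ℕP.+-monoʳ-≤ c₀ (ℕP.n≤1+n b))))

  All≤-⊕⁻ʳ : ∀ {k} (u v : Vec ℕ k) → All (_≤ r) (u ⊕ v) → All (_≤ r) v
  All≤-⊕⁻ʳ []       []       []            = []
  All≤-⊕⁻ʳ (u ∷ us) (v ∷ vs) (u+v≤r ∷ ≤r) = ℕP.≤-trans (ℕP.m≤n+m v u) u+v≤r ∷ All≤-⊕⁻ʳ us vs ≤r

  expSubset≤expBins : ∀ {n k} (p : Fin n → ℚ) → (∀ i → 0ℚ ≤ℚ p i) → (∀ i → p i ≤ℚ q) →
    (S : Vec (Subset n) k) (c ms : Vec ℕ k) → All (_≤ r) ms → FitsFrom 0 S ms →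
    expSubset p (λ A → maxℚ 0 (c ⊕ counts S A)) ≤ℚ expBins ms (λ bs → maxℚ 0 (c ⊕ bs))
  expSubset≤expBins {zero} p _ _ S c ms ms≤r _ rewrite counts-empty S c = maxℚ≤expBins 0 c ms ms≤r
  expSubset≤expBins {suc n} {k} p 0≤p p≤q S c ms ms≤r fits with FitsFrom-zero S fits
  ... | ms′ , refl , fits′ = begin
    expSubset p (λ A → maxℚ 0 (c ⊕ counts S A))
      ≡⟨ expSubset-counts p S c (maxℚ 0) ⟩
    p zero * expSubset (p ∘ suc) (λ A → maxℚ 0 ((c ⊕ H) ⊕ counts S′ A))
      + (1ℚ - p zero) * expSubset (p ∘ suc) (λ A → maxℚ 0 (c ⊕ counts S′ A))
      ≤⟨ QP.+-mono-≤ (*-monoˡ-≤ (0≤p zero) (recurse (c ⊕ H))) (*-monoˡ-≤ 0≤1-p₀ (recurse c)) ⟩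
    p zero * expBins ms′ (λ bs → maxℚ 0 ((c ⊕ H) ⊕ bs)) + (1ℚ - p zero) * Y
      ≡⟨ cong (λ x → p zero * x + (1ℚ - p zero) * Y) (expBins-⊕-assoc 0 c H ms′) ⟩
    p zero * X + (1ℚ - p zero) * Y
      ≤⟨ mixture-mono (p≤q zero) Y≤X ⟩
    q * X + (1ℚ - q) * Y
      ≤⟨ sharedCoin≤independentCoins 0 (heads S) c ms′ ms≤r ⟩
    expBins (H ⊕ ms′) (λ bs → maxℚ 0 (c ⊕ bs)) ∎
    where
    H : Vec ℕ k
    H = indicator (heads S)
    S′ : Vec (Subset n) k
    S′ = tails S
    ms′≤r : All (_≤ r) ms′
    ms′≤r = All≤-⊕⁻ʳ H ms′ ms≤r
    0≤1-p₀ : 0ℚ ≤ℚ 1ℚ - p zero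
    0≤1-p₀ = p≤q⇒0≤q-p (QP.≤-trans (p≤q zero) q≤1)
    X Y : ℚ
    X = expBins ms′ (λ bs → maxℚ 0 (c ⊕ (H ⊕ bs)))
    Y = expBins ms′ (λ bs → maxℚ 0 (c ⊕ bs))
    recurse : ∀ c → expSubset (p ∘ suc) (λ A → maxℚ 0 (c ⊕ counts S′ A))
                      ≤ℚ expBins ms′ (λ bs → maxℚ 0 (c ⊕ bs))
    recurse c = expSubset≤expBins (p ∘ suc) (0≤p ∘ suc) (p≤q ∘ suc) S′ c ms′ ms′≤r fits′
    Y≤X : Y ≤ℚ X
    Y≤X = expBins-mono ms′ (λ bs →
      maxℚ-mono 0 (c ⊕ bs) (c ⊕ (H ⊕ bs)) (maxVec-indicator-≥ (heads S) c bs))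

  expSubset≤prefixSum+expBins : ∀ {n k} (p : Fin n → ℚ) → (∀ i → 0ℚ ≤ℚ p i) → (∀ i → p i ≤ℚ 1ℚ) →
    ∀ h → (∀ j → h ≤ toℕ j → p j ≤ℚ q) →
    (S : Vec (Subset n) k) (c ms : Vec ℕ k) → All (_≤ r) ms → FitsFrom h S ms →
    expSubset p (λ A → maxℚ 0 (c ⊕ counts S A)) ≤ℚ prefixSum p h + expBins ms (λ bs → maxℚ 0 (c ⊕ bs))
  expSubset≤prefixSum+expBins p 0≤p _ zero p≤q S c ms ms≤r fits = begin
    expSubset p (λ A → maxℚ 0 (c ⊕ counts S A))
      ≤⟨ expSubset≤expBins p 0≤p (λ j → p≤q j z≤n) S c ms ms≤r fits ⟩
    expBins ms (λ bs → maxℚ 0 (c ⊕ bs))          ≡⟨ QP.+-identityˡ _ ⟨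
    0ℚ + expBins ms (λ bs → maxℚ 0 (c ⊕ bs))     ∎
  expSubset≤prefixSum+expBins {zero} p _ _ (suc h) _ S c ms ms≤r _ rewrite counts-empty S c = begin
    maxℚ 0 c                                          ≤⟨ maxℚ≤expBins 0 c ms ms≤r ⟩
    expBins ms (λ bs → maxℚ 0 (c ⊕ bs))               ≡⟨ QP.+-identityˡ _ ⟨
    0ℚ + expBins ms (λ bs → maxℚ 0 (c ⊕ bs))          ≡⟨ cong (_+ _) (prefixSum-empty p (suc h)) ⟨
    prefixSum p (suc h) + expBins ms (λ bs → maxℚ 0 (c ⊕ bs)) ∎
  expSubset≤prefixSum+expBins {suc n} {k} p 0≤p p≤1 (suc h) p≤q S c ms ms≤r fits = begin
    expSubset p (λ A → maxℚ 0 (c ⊕ counts S A))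
      ≡⟨ expSubset-counts p S c (maxℚ 0) ⟩
    p zero * expSubset (p ∘ suc) (λ A → maxℚ 0 ((c ⊕ H) ⊕ counts S′ A))
      + (1ℚ - p zero) * expSubset (p ∘ suc) (λ A → maxℚ 0 (c ⊕ counts S′ A))
      ≤⟨ QP.+-mono-≤ (*-monoˡ-≤ (0≤p zero) (recurse (c ⊕ H)))
                     (*-monoˡ-≤ (p≤q⇒0≤q-p (p≤1 zero)) (recurse c)) ⟩
    p zero * (P + X) + (1ℚ - p zero) * (P + W)
      ≤⟨ QP.+-monoˡ-≤ _ (*-monoˡ-≤ (0≤p zero) (QP.+-monoʳ-≤ P X≤1+W)) ⟩
    p zero * (P + (1ℚ + W)) + (1ℚ - p zero) * (P + W)
      ≡⟨ solve 3 (λ x P W → x :* (P :+ (con 1ℚ :+ W)) :+ (con 1ℚ :- x) :* (P :+ W) := (x :+ P) :+ W)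
                 refl (p zero) P W ⟩
    (p zero + P) + W
      ≡⟨ cong (_+ W) (prefixSum-suc p h) ⟨
    prefixSum p (suc h) + W ∎
    where
    H : Vec ℕ k
    H = indicator (heads S)
    S′ : Vec (Subset n) k
    S′ = tails S
    P X W : ℚ
    P = prefixSum (p ∘ suc) h
    X = expBins ms (λ bs → maxℚ 0 ((c ⊕ H) ⊕ bs))
    W = expBins ms (λ bs → maxℚ 0 (c ⊕ bs))
    recurse : ∀ c → expSubset (p ∘ suc) (λ A → maxℚ 0 (c ⊕ counts S′ A))
                      ≤ℚ P + expBins ms (λ bs → maxℚ 0 (c ⊕ bs))
    recurse c = expSubset≤prefixSum+expBins (p ∘ suc) (0≤p ∘ suc) (p≤1 ∘ suc) h
                  (λ j h≤j → p≤q (suc j) (s≤s h≤j)) S′ c ms ms≤r (FitsFrom-suc S fits)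
    X≤1+W : X ≤ℚ 1ℚ + W
    X≤1+W = begin
      X
        ≡⟨ expBins-⊕-assoc 0 c H ms ⟩
      expBins ms (λ bs → maxℚ 0 (c ⊕ (H ⊕ bs)))
        ≤⟨ expBins-mono ms (λ bs → maxℚ-≤1+ 0 (c ⊕ (H ⊕ bs)) (c ⊕ bs) (maxVec-indicator-≤ (heads S) c bs)) ⟩
      expBins ms (λ bs → 1ℚ + maxℚ 0 (c ⊕ bs))
        ≡⟨ expBins-1+ ms _ ms≤r ⟩
      1ℚ + W ∎

  -- expMaxBin weights an outcome by a product computed in a local function that cannot be
  -- named from outside; unifying against its unfolding recovers it, with its defining equations.
  private
    summand : ∀ k → Σ (Vec ℕ k → ℚ) λ g →
      expMaxBin r k q ≡ sumℚ (List.map g (allVecs (List.upTo (suc r)) k))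
    summand k = _ , refl

    weight : ∀ m → Σ (Vec ℕ m → ℚ) λ w →
      ∀ b bs → proj₁ (summand (suc m)) (b ∷ bs) ≡ binPmf r q b * w bs * ℕ→ℚ (maxVec (b ∷ bs))
    weight m = _ , λ b bs → refl

  binWeight : ∀ {k} → Vec ℕ k → ℚ
  binWeight {k} = proj₁ (weight k)

  sumℚ-binWeight≡expBins : ∀ k (f : Vec ℕ k → ℚ) →
    sumℚ (List.map (λ bs → binWeight bs * f bs) (allVecs (List.upTo (suc r)) k))
      ≡ expBins (Vec.replicate k r) f
  sumℚ-binWeight≡expBins zero    f = trans (QP.+-identityʳ _) (QP.*-identityˡ (f []))
  sumℚ-binWeight≡expBins (suc k) f = begin-equality
    sumℚ (List.map (λ bs → binWeight bs * f bs) (allVecs values (suc k)))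
      ≡⟨ sumℚ-allVecs-suc values k _ ⟩
    sumℚ (List.map part values)
      ≡⟨ cong sumℚ (ListP.map-cong factor values) ⟩
    sumℚ (List.map (λ b → binPmf r q b * expBins (Vec.replicate k r) (f ∘ (b ∷_))) values)
      ≡⟨ sumℚ-map-upTo (suc r) (λ b → binPmf r q b * expBins (Vec.replicate k r) (f ∘ (b ∷_))) ⟩
    expBins (Vec.replicate (suc k) r) f ∎
    where
    values : List ℕ
    values = List.upTo (suc r)
    part : ℕ → ℚ
    part b = sumℚ (List.map (λ bs → binWeight (b ∷ bs) * f (b ∷ bs)) (allVecs values k))
    factor : ∀ b → part b ≡ binPmf r q b * expBins (Vec.replicate k r) (f ∘ (b ∷_))
    factor b = begin-equality
      part b
        ≡⟨ cong sumℚ (ListP.map-cong (λ bs → QP.*-assoc (binPmf r q b) (binWeight bs) (f (b ∷ bs)))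
                                     (allVecs values k)) ⟩
      sumℚ (List.map (λ bs → binPmf r q b * (binWeight bs * f (b ∷ bs))) (allVecs values k))
        ≡⟨ sumℚ-map-*ˡ (binPmf r q b) _ (allVecs values k) ⟩
      binPmf r q b * sumℚ (List.map (λ bs → binWeight bs * f (b ∷ bs)) (allVecs values k))
        ≡⟨ cong (binPmf r q b *_) (sumℚ-binWeight≡expBins k (f ∘ (b ∷_))) ⟩
      binPmf r q b * expBins (Vec.replicate k r) (f ∘ (b ∷_)) ∎

  expMaxBin≡expBins : ∀ k → expMaxBin r k q ≡ expBins (Vec.replicate k r) (λ bs → ℕ→ℚ (maxVec bs))
  expMaxBin≡expBins k = sumℚ-binWeight≡expBins k (λ bs → ℕ→ℚ (maxVec bs))

  All≤-replicate : ∀ k → All (_≤ r) (Vec.replicate k r)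
  All≤-replicate zero    = []
  All≤-replicate (suc k) = ℕP.≤-refl ∷ All≤-replicate k

  value≤prefixSum+expMaxBin : ∀ {n k} (p : Fin n → ℚ) → (∀ i → 0ℚ ≤ℚ p i) → (∀ i → p i ≤ℚ 1ℚ) →
    ∀ h → (∀ j → h ≤ toℕ j → p j ≤ℚ q) → (S : Vec (Subset n) k) → IsPortfolio r k S →
    value p S ≤ℚ prefixSum p h + expMaxBin r k q
  value≤prefixSum+expMaxBin {k = k} p 0≤p p≤1 h p≤q S portfolio = begin
    value p S
      ≡⟨ sumℚ-probSet≡expSubset p (λ A → ℕ→ℚ (maxVec (counts S A))) ⟩
    expSubset p (λ A → ℕ→ℚ (maxVec (counts S A)))
      ≡⟨ expSubset-cong p (λ A → maxℚ-zeros (counts S A)) ⟨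
    expSubset p (λ A → maxℚ 0 (zeros ⊕ counts S A))
      ≤⟨ expSubset≤prefixSum+expBins p 0≤p p≤1 h p≤q S zeros rs
           (All≤-replicate k) (IsPortfolio⇒FitsFrom h S portfolio) ⟩
    prefixSum p h + expBins rs (λ bs → maxℚ 0 (zeros ⊕ bs))
      ≡⟨ cong (prefixSum p h +_) (trans (expBins-cong rs maxℚ-zeros) (sym (expMaxBin≡expBins k))) ⟩
    prefixSum p h + expMaxBin r k q ∎
    where
    zeros rs : Vec ℕ k
    zeros = Vec.replicate k 0
    rs = Vec.replicate k r

pAt-preserves : ∀ {n} (P : ℚ → Set) (p : Fin n → ℚ) → P 0ℚ → (∀ i → P (p i)) → ∀ j → P (pAt p j)
pAt-preserves {zero}  P p P0 Pp j       = P0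
pAt-preserves {suc n} P p P0 Pp zero    = Pp zero
pAt-preserves {suc n} P p P0 Pp (suc j) = pAt-preserves P (p ∘ suc) P0 (Pp ∘ suc) j

pAt-dominates : ∀ {n} (p : Fin n → ℚ) → (∀ i j → i Data.Fin.≤ j → p j ≤ℚ p i) →
  ∀ h j → h ≤ toℕ j → p j ≤ℚ pAt p h
pAt-dominates {suc n} p antitone zero    j       _         = antitone zero j z≤n
pAt-dominates {suc n} p antitone (suc h) (suc j) (s≤s h≤j) =
  pAt-dominates (p ∘ suc) (λ i j i≤j → antitone (suc i) (suc j) (s≤s i≤j)) h j h≤j

x≤a+b∧a<½x⇒½x<b : ∀ {x a b} → x ≤ℚ a + b → a <ℚ ½ * x → ½ * x <ℚ b
x≤a+b∧a<½x⇒½x<b {x} {a} {b} x≤a+b a<½x = +-cancelˡ-< (½ * x) (begin-strict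
  ½ * x + ½ * x  ≡⟨ solve 1 (λ x → con ½ :* x :+ con ½ :* x := x) refl x ⟩
  x              ≤⟨ x≤a+b ⟩
  a + b          <⟨ QP.+-monoˡ-< b a<½x ⟩
  ½ * x + b      ∎)
  where open QP.≤-Reasoning

lemma4p2 : (n r k : ℕ) → r ≤ n → k ≥ 1
    → (p : Fin n → ℚ)
    → (∀ i → 0ℚ Q.≤ p i) → (∀ i → p i Q.≤ 1ℚ)
    → (∀ i j → i Data.Fin.≤ j → p j Q.≤ p i)
    → (OPT : ℚ) → IsOPT p r k OPT
    → (Defs.ℕ→ℚ 200) Q.≤ OPT
    → (Mstar : ℕ) → Mstar ≤ n
    → prefixSum p Mstar Q.< ½ * OPT
    → (∀ j → j ≤ n → prefixSum p j Q.< ½ * OPT → j ≤ Mstar)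
    → ½ * OPT Q.≤ expMaxBin r k (pAt p Mstar)
lemma4p2 n r k _ _ p 0≤p p≤1 antitone OPT ((S , portfolio , value≡OPT) , _) _ Mstar _ prefix<½OPT _ =
  QP.<⇒≤ (x≤a+b∧a<½x⇒½x<b OPT≤prefix+E prefix<½OPT)
  where
  q : ℚ
  q = pAt p Mstar
  open Binomial r q (pAt-preserves (0ℚ ≤ℚ_) p QP.≤-refl 0≤p Mstar)
                    (pAt-preserves (_≤ℚ 1ℚ) p 0≤1 p≤1 Mstar)
  OPT≤prefix+E : OPT ≤ℚ prefixSum p Mstar + expMaxBin r k q
  OPT≤prefix+E = subst (_≤ℚ prefixSum p Mstar + expMaxBin r k q) value≡OPT
    (value≤prefixSum+expMaxBin p 0≤p p≤1 Mstar (pAt-dominates p antitone Mstar) S portfolio)
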